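{- For integers $r\le k<n$, $$S^B_q(n,k,r)=S^B_q(n-1,k-1,r)+[2k+1]_q\, S^B_q(n-1,k,r),$$ with $S^B_q(r,r,r)=1$, and $S^B_q(n,k,r)=0$ whenever $k<r$, $k>n$, or $n<r$.
   Context: For an integer $m\ge 0$, $[m]_q=1+q+\cdots+q^{m-1}$. A restricted growth word of type $B$ of the second kind of length $n$ is a word $\omega=\omega_1\cdots\omega_n$ with letters in $\{0,\pm1,\dots,\pm n\}$ such that, writing $M_{t-1}=\max\{0,|\omega_1|,\dots,|\omega_{t-1}|\}$ ($M_0=0$), for every $t$ either $|\omega_t|\le M_{t-1}$ or $\omega_t=M_{t-1}+1$. Let $R^B_{(ii)}(n,k)$ be the set of such words with $\max_t|\omega_t|=k$, and let $R^B_{(ii)}(n,k,r)$ be the subset of those words whose first $r$ letters are $1,2,\dots,r$ in this order (empty if $n<r$). The weight of $\omega$ is $\mathrm{wt}(\omega)=\prod_{t=1}^n \mathrm{wt}_t(\omega)$, where $\mathrm{wt}_t(\omega)=1$ if $\omega_t=0$ or $\omega_t=M_{t-1}+1$; $q^{2|\omega_t|-1}$ if $|\omega_t|\le M_{t-1}$ and $\omega_t<0$; $q^{2\omega_t}$ if $1\le \omega_t\le M_{t-1}$. Define $S^B_q(n,k,r)=\sum_{\omega\in R^B_{(ii)}(n,k,r)}\mathrm{wt}(\omega)$. -}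

module Defs where

open import Level using (Level)
open import Data.Bool using (Bool; true; false; _∧_; _∨_; if_then_else_)
open import Data.Nat as ℕ using (ℕ; zero; suc; _⊔_; _≤ᵇ_; _≡ᵇ_)
open import Data.Integer as ℤ using (ℤ; +_; -[1+_]; ∣_∣)
open import Data.List using (List; []; _∷_; map; concatMap; filterᵇ; foldr; take; upTo; length)
open import Algebra.Bundles using (CommutativeSemiring)

letters : ℕ → List ℤ
letters n = + 0 ∷ concatMap (λ i → + suc i ∷ -[1+ i ] ∷ []) (upTo n)

wordsOver : ℕ → ℕ → List (List ℤ)
wordsOver n zero = [] ∷ []
wordsOver n (suc len) = concatMap (λ a → map (a ∷_) (wordsOver n len)) (letters n)

infix 4 _==ℤ_ _==L_
_==ℤ_ : ℤ → ℤ → Bool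
(+ m) ==ℤ (+ n) = m ≡ᵇ n
-[1+ m ] ==ℤ -[1+ n ] = m ≡ᵇ n
_ ==ℤ _ = false

_==L_ : List ℤ → List ℤ → Bool
[] ==L [] = true
(a ∷ as) ==L (b ∷ bs) = (a ==ℤ b) ∧ (as ==L bs)
_ ==L _ = false

-- restricted growth condition, given M = M_{t-1} = max{0,|ω_1|,...,|ω_{t-1}|}:
-- every letter satisfies |ω_t| ≤ M_{t-1} or ω_t = M_{t-1} + 1
rgFrom : ℕ → List ℤ → Bool
rgFrom M [] = true
rgFrom M (w ∷ ws) = ((∣ w ∣ ≤ᵇ M) ∨ (w ==ℤ + suc M)) ∧ rgFrom (M ⊔ ∣ w ∣) ws

isRG : List ℤ → Bool
isRG = rgFrom 0

maxAbs : List ℤ → ℕ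
maxAbs = foldr (λ w m → ∣ w ∣ ⊔ m) 0

-- the first r letters are 1, 2, ..., r in this order (false if length < r)
hasPrefix : ℕ → List ℤ → Bool
hasPrefix r ω = take r ω ==L map (λ i → + suc i) (upTo r)

-- membership in R^B_(ii)(n,k,r), for a word of length n with letters in {0,±1,...,±n};
-- k is an integer (negative k gives the empty set)
inR : ℤ → ℕ → List ℤ → Bool
inR k r ω = isRG ω ∧ ((+ maxAbs ω) ==ℤ k) ∧ hasPrefix r ω

RB : ℕ → ℤ → ℕ → List (List ℤ)
RB n k r = filterᵇ (inR k r) (wordsOver n n)

-- Weights, valued in an arbitrary commutative semiring (q an element of it;
-- taking the semiring ℕ[q] recovers the polynomial identity).

module _ {c ℓ : Level} (R : CommutativeSemiring c ℓ) where
  open CommutativeSemiring R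

  pow : Carrier → ℕ → Carrier
  pow q zero = 1#
  pow q (suc m) = q * pow q m

  qint : Carrier → ℕ → Carrier
  qint q zero = 0#
  qint q (suc m) = 1# + q * qint q m

  wtLetter : Carrier → ℕ → ℤ → Carrier
  wtLetter q M (+ zero) = 1#
  wtLetter q M (+ suc i) = if suc i ≤ᵇ M then pow q (2 ℕ.* suc i) else 1#
  wtLetter q M -[1+ i ] = if suc i ≤ᵇ M then pow q (2 ℕ.* suc i ℕ.∸ 1) else 1#

  wtFrom : Carrier → ℕ → List ℤ → Carrier
  wtFrom q M [] = 1#
  wtFrom q M (w ∷ ws) = wtLetter q M w * wtFrom q (M ⊔ ∣ w ∣) ws

  wt : Carrier → List ℤ → Carrier
  wt q = wtFrom q 0

  sumR : List Carrier → Carrier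
  sumR = foldr _+_ 0#

  SB : Carrier → ℕ → ℤ → ℕ → Carrier
  SB q n k r = sumR (map (wt q) (RB n k r))

-- A restricted growth word is read letter by letter, tracking the running maximum M.
-- Among the letters available at that point, 0 and ±1, …, ±M keep the maximum and
-- carry total weight 1 + Σ_{i=1}^{M} (q^{2i} + q^{2i-1}) = [2M+1]_q, while the letter
-- M+1 raises it with weight 1.  Hence the weighted count of continuations of length L
-- from maximum M ending at maximum K satisfies a recurrence that no longer refers to
-- the alphabet; unfolding it from the other end gives the recurrence in K.  The forced
-- prefix 1, 2, …, r just starts the count at maximum r.

module Submission where

open import Level using (Level)
open import Function using (_∘_; id)
open import Function.Bundles using (Equivalence)
open import Data.Bool using (Bool; true; false; _∧_; _∨_; if_then_else_; T)
open import Data.Bool.Properties using (T-≡)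
open import Data.Empty using (⊥-elim)
open import Data.Nat as ℕ using (ℕ; zero; suc; _∸_; _<_; _≤_; _⊔_; _≤ᵇ_; _≡ᵇ_; z≤n; s≤s)
import Data.Nat.Properties as ℕₚ
open import Data.Integer using (ℤ; +_; -[1+_]; ∣_∣; 1ℤ; +≤+; +<+) renaming (_≤_ to _≤ℤ_; _<_ to _<ℤ_; _-_ to _-ℤ_)
import Data.Integer.Properties as ℤₚ
open import Data.List using (List; []; _∷_; map; concatMap; filterᵇ; take; upTo; applyUpTo; _++_)
open import Data.List.Properties using (map-∘)
open import Data.Product using (_×_; _,_)
open import Data.Sum using (_⊎_; inj₁; inj₂)
open import Relation.Binary.PropositionalEquality as ≡ using (_≡_; _≢_)
open import Relation.Nullary using (¬_; yes; no)
open import Algebra.Bundles using (CommutativeSemiring)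

open import Defs

≤ᵇ-true : ∀ {m n} → m ≤ n → (m ≤ᵇ n) ≡ true
≤ᵇ-true le = Equivalence.to T-≡ (ℕₚ.≤⇒≤ᵇ le)

¬T⇒false : ∀ {b} → ¬ T b → b ≡ false
¬T⇒false {false} _ = ≡.refl
¬T⇒false {true} ¬t = ⊥-elim (¬t _)

≤ᵇ-false : ∀ {m n} → n < m → (m ≤ᵇ n) ≡ false
≤ᵇ-false {m} {n} n<m = ¬T⇒false (ℕₚ.<⇒≱ n<m ∘ ℕₚ.≤ᵇ⇒≤ m n)

≡ᵇ-refl : ∀ n → (n ≡ᵇ n) ≡ true
≡ᵇ-refl n = Equivalence.to T-≡ (ℕₚ.≡⇒≡ᵇ n n ≡.refl)

≡ᵇ-false : ∀ {m n} → m ≢ n → (m ≡ᵇ n) ≡ false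
≡ᵇ-false {m} {n} m≢n = ¬T⇒false (m≢n ∘ ℕₚ.≡ᵇ⇒≡ m n)

+==ℤ⇒≡ : ∀ m k → (+ m ==ℤ k) ≡ true → k ≡ + m
+==ℤ⇒≡ m (+ k) eq = ≡.cong +_ (≡.sym (ℕₚ.≡ᵇ⇒≡ m k (≡.subst T (≡.sym eq) _)))

==ℤ-pred : ∀ m k → (+ m ==ℤ k -ℤ 1ℤ) ≡ (+ suc m ==ℤ k)
==ℤ-pred m (+ zero) = ≡.refl
==ℤ-pred m (+ suc k) = ≡.refl
==ℤ-pred m -[1+ k ] = ≡.refl

ascending : ℕ → ℕ → List ℤ
ascending m zero = []
ascending m (suc j) = + suc m ∷ ascending (suc m) j

map-+suc-applyUpTo : ∀ j (f : ℕ → ℕ) m → (∀ i → f i ≡ m ℕ.+ i) →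
  map (λ i → + suc i) (applyUpTo f j) ≡ ascending m j
map-+suc-applyUpTo zero f m f≗m+ = ≡.refl
map-+suc-applyUpTo (suc j) f m f≗m+ =
  ≡.cong₂ _∷_ (≡.cong (λ i → + suc i) (≡.trans (f≗m+ 0) (ℕₚ.+-identityʳ m)))
              (map-+suc-applyUpTo j (f ∘ suc) (suc m) (λ i → ≡.trans (f≗m+ (suc i)) (ℕₚ.+-suc m i)))

map-+suc-upTo : ∀ j → map (λ i → + suc i) (upTo j) ≡ ascending 0 j
map-+suc-upTo j = map-+suc-applyUpTo j id 0 (λ _ → ≡.refl)

module Sums {c ℓ : Level} (R : CommutativeSemiring c ℓ) where
  open CommutativeSemiring R

  ∑ : {A : Set} → (A → Carrier) → List A → Carrier
  ∑ f xs = sumR R (map f xs)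

  ∑-++ : {A : Set} (f : A → Carrier) (xs ys : List A) → ∑ f (xs ++ ys) ≈ ∑ f xs + ∑ f ys
  ∑-++ f [] ys = sym (+-identityˡ _)
  ∑-++ f (x ∷ xs) ys = trans (+-cong refl (∑-++ f xs ys)) (sym (+-assoc _ _ _))

  ∑-concatMap : {A B : Set} (f : B → Carrier) (g : A → List B) (xs : List A) →
    ∑ f (concatMap g xs) ≈ ∑ (λ x → ∑ f (g x)) xs
  ∑-concatMap f g [] = refl
  ∑-concatMap f g (x ∷ xs) = trans (∑-++ f (g x) (concatMap g xs)) (+-cong refl (∑-concatMap f g xs))

  ∑-map : {A B : Set} (f : B → Carrier) (g : A → B) (xs : List A) → ∑ f (map g xs) ≡ ∑ (f ∘ g) xs
  ∑-map f g xs = ≡.cong (sumR R) (≡.sym (map-∘ xs))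

  ∑-cong : {A : Set} {f g : A → Carrier} (xs : List A) → (∀ x → f x ≈ g x) → ∑ f xs ≈ ∑ g xs
  ∑-cong [] f≈g = refl
  ∑-cong (x ∷ xs) f≈g = +-cong (f≈g x) (∑-cong xs f≈g)

  ∑-zero : {A : Set} {f : A → Carrier} (xs : List A) → (∀ x → f x ≈ 0#) → ∑ f xs ≈ 0#
  ∑-zero [] f≈0 = refl
  ∑-zero (x ∷ xs) f≈0 = trans (+-cong (f≈0 x) (∑-zero xs f≈0)) (+-identityˡ _)

  ∑-*ˡ : {A : Set} (a : Carrier) (f : A → Carrier) (xs : List A) → ∑ (λ x → a * f x) xs ≈ a * ∑ f xs
  ∑-*ˡ a f [] = sym (zeroʳ a)
  ∑-*ˡ a f (x ∷ xs) = trans (+-cong refl (∑-*ˡ a f xs)) (sym (distribˡ a _ _))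

  ∑-filterᵇ : {A : Set} (f : A → Carrier) (p : A → Bool) (xs : List A) →
    ∑ f (filterᵇ p xs) ≈ ∑ (λ x → if p x then f x else 0#) xs
  ∑-filterᵇ f p [] = refl
  ∑-filterᵇ f p (x ∷ xs) with p x
  ... | true = +-cong refl (∑-filterᵇ f p xs)
  ... | false = trans (∑-filterᵇ f p xs) (sym (+-identityˡ _))

  if-≈0# : ∀ b {x} → x ≈ 0# → (if b then x else 0#) ≈ 0#
  if-≈0# true x≈0 = x≈0
  if-≈0# false x≈0 = refl

  ∑-if-∧ : {A : Set} (b : Bool) (p : A → Bool) (f : A → Carrier) (xs : List A) →
    ∑ (λ x → if b ∧ p x then f x else 0#) xs ≈ (if b then ∑ (λ x → if p x then f x else 0#) xs else 0#)
  ∑-if-∧ true p f xs = refl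
  ∑-if-∧ false p f xs = ∑-zero xs (λ _ → refl)

  ∑-if-*ˡ : {A : Set} (b : Bool) (a : Carrier) (f : A → Carrier) (xs : List A) →
    ∑ (λ x → if b then a * f x else 0#) xs ≈ (if b then a * ∑ f xs else 0#)
  ∑-if-*ˡ true a f xs = ∑-*ˡ a f xs
  ∑-if-*ˡ false a f xs = ∑-zero xs (λ _ → refl)

  ∑< : (ℕ → Carrier) → ℕ → Carrier
  ∑< h zero = 0#
  ∑< h (suc n) = h 0 + ∑< (h ∘ suc) n

  ∑-applyUpTo : (g : ℕ → Carrier) (f : ℕ → ℕ) (n : ℕ) → ∑ g (applyUpTo f n) ≡ ∑< (g ∘ f) n
  ∑-applyUpTo g f zero = ≡.refl
  ∑-applyUpTo g f (suc n) = ≡.cong (λ s → g (f 0) + s) (∑-applyUpTo g (f ∘ suc) n)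

  ∑<-cong : {h h′ : ℕ → Carrier} (n : ℕ) → (∀ i → i < n → h i ≈ h′ i) → ∑< h n ≈ ∑< h′ n
  ∑<-cong zero h≈h′ = refl
  ∑<-cong (suc n) h≈h′ = +-cong (h≈h′ 0 (s≤s z≤n)) (∑<-cong n (λ i i<n → h≈h′ (suc i) (s≤s i<n)))

  ∑<-zero : {h : ℕ → Carrier} (n : ℕ) → (∀ i → i < n → h i ≈ 0#) → ∑< h n ≈ 0#
  ∑<-zero zero h≈0 = refl
  ∑<-zero (suc n) h≈0 =
    trans (+-cong (h≈0 0 (s≤s z≤n)) (∑<-zero n (λ i i<n → h≈0 (suc i) (s≤s i<n)))) (+-identityˡ _)

  ∑<-*ˡ : (h : ℕ → Carrier) (a : Carrier) (n : ℕ) → ∑< (λ i → a * h i) n ≈ a * ∑< h n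
  ∑<-*ˡ h a zero = sym (zeroʳ a)
  ∑<-*ˡ h a (suc n) = trans (+-cong refl (∑<-*ˡ (h ∘ suc) a n)) (sym (distribˡ a _ _))

  ∑<-*ʳ : (h : ℕ → Carrier) (a : Carrier) (n : ℕ) → ∑< (λ i → h i * a) n ≈ ∑< h n * a
  ∑<-*ʳ h a zero = sym (zeroˡ a)
  ∑<-*ʳ h a (suc n) = trans (+-cong refl (∑<-*ʳ (h ∘ suc) a n)) (sym (distribʳ a _ _))

  ∑<-+ : (h : ℕ → Carrier) (m n : ℕ) → ∑< h (m ℕ.+ n) ≈ ∑< h m + ∑< (λ i → h (m ℕ.+ i)) n
  ∑<-+ h zero n = sym (+-identityˡ _)
  ∑<-+ h (suc m) n = trans (+-cong refl (∑<-+ (h ∘ suc) m n)) (sym (+-assoc _ _ _))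

  ∑<-truncate : (h : ℕ → Carrier) (m n : ℕ) → m < n → (∀ i → m < i → h i ≈ 0#) → ∑< h n ≈ ∑< h m + h m
  ∑<-truncate h m n m<n h≈0 = begin
      ∑< h n                                                  ≡⟨ ≡.cong (∑< h) (≡.sym n≡m+1+d) ⟩
      ∑< h (m ℕ.+ suc d)                                      ≈⟨ ∑<-+ h m (suc d) ⟩
      ∑< h m + (h (m ℕ.+ 0) + ∑< (λ i → h (m ℕ.+ suc i)) d)  ≈⟨ +-cong refl (+-cong (reflexive (≡.cong h (ℕₚ.+-identityʳ m))) tail≈0) ⟩
      ∑< h m + (h m + 0#)                                     ≈⟨ +-cong refl (+-identityʳ _) ⟩
      ∑< h m + h m                                            ∎
    where
      open import Relation.Binary.Reasoning.Setoid setoid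
      d = n ∸ suc m
      n≡m+1+d : m ℕ.+ suc d ≡ n
      n≡m+1+d = ≡.trans (ℕₚ.+-suc m d) (ℕₚ.m+[n∸m]≡n m<n)
      tail≈0 : ∑< (λ i → h (m ℕ.+ suc i)) d ≈ 0#
      tail≈0 = ∑<-zero d (λ i _ → h≈0 (m ℕ.+ suc i) (ℕₚ.m<m+n m (s≤s z≤n)))

  ∑-letters : (h : ℤ → Carrier) (A : ℕ) → ∑ h (letters A) ≈ h (+ 0) + ∑< (λ i → h (+ suc i) + h -[1+ i ]) A
  ∑-letters h A = +-cong refl (begin
      ∑ h (concatMap (λ i → + suc i ∷ -[1+ i ] ∷ []) (upTo A))  ≈⟨ ∑-concatMap h _ (upTo A) ⟩
      ∑ (λ i → h (+ suc i) + (h -[1+ i ] + 0#)) (upTo A)        ≡⟨ ∑-applyUpTo _ id A ⟩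
      ∑< (λ i → h (+ suc i) + (h -[1+ i ] + 0#)) A             ≈⟨ ∑<-cong A (λ i _ → +-cong refl (+-identityʳ _)) ⟩
      ∑< (λ i → h (+ suc i) + h -[1+ i ]) A                    ∎)
    where open import Relation.Binary.Reasoning.Setoid setoid

  ∑-select-letter : (h : ℤ → Carrier) (m A : ℕ) → m < A →
    ∑ (λ a → if a ==ℤ + suc m then h a else 0#) (letters A) ≈ h (+ suc m)
  ∑-select-letter h m A m<A = begin
      ∑ selected (letters A)    ≈⟨ ∑-letters selected A ⟩
      0# + ∑< pair A            ≈⟨ +-identityˡ _ ⟩
      ∑< pair A                 ≈⟨ ∑<-truncate pair m A m<A (λ i m<i → pair-off i (ℕₚ.>⇒≢ m<i)) ⟩
      ∑< pair m + pair m        ≈⟨ +-cong (∑<-zero m (λ i i<m → pair-off i (ℕₚ.<⇒≢ i<m))) pair-on ⟩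
      0# + h (+ suc m)          ≈⟨ +-identityˡ _ ⟩
      h (+ suc m)               ∎
    where
      open import Relation.Binary.Reasoning.Setoid setoid
      selected : ℤ → Carrier
      selected a = if a ==ℤ + suc m then h a else 0#
      pair : ℕ → Carrier
      pair i = selected (+ suc i) + selected -[1+ i ]
      pair-off : ∀ i → i ≢ m → pair i ≈ 0#
      pair-off i i≢m rewrite ≡ᵇ-false i≢m = +-identityˡ _
      pair-on : pair m ≈ h (+ suc m)
      pair-on rewrite ≡ᵇ-refl m = +-identityʳ _

  ∑-wordsOver-suc : (A L : ℕ) (φ : List ℤ → Carrier) →
    ∑ φ (wordsOver A (suc L)) ≈ ∑ (λ a → ∑ (φ ∘ (a ∷_)) (wordsOver A L)) (letters A)
  ∑-wordsOver-suc A L φ =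
    trans (∑-concatMap φ (λ a → map (a ∷_) (wordsOver A L)) (letters A))
          (∑-cong (letters A) (λ a → reflexive (∑-map φ (a ∷_) (wordsOver A L))))

  ∑-prefixed : ∀ (A m j L : ℕ) (g : List ℤ → Carrier) → m ℕ.+ j ≤ A →
    ∑ (λ ws → if take j ws ==L ascending m j then g ws else 0#) (wordsOver A (j ℕ.+ L))
      ≈ ∑ (g ∘ (ascending m j ++_)) (wordsOver A L)
  ∑-prefixed A m zero L g _ = refl
  ∑-prefixed A m (suc j) L g m+1+j≤A = begin
      ∑ (λ ws → if take (suc j) ws ==L ascending m (suc j) then g ws else 0#) (wordsOver A (suc j ℕ.+ L))
        ≈⟨ ∑-wordsOver-suc A (j ℕ.+ L) _ ⟩
      ∑ (λ a → ∑ (λ ws → if (a ==ℤ + suc m) ∧ prefixed ws then g (a ∷ ws) else 0#) (wordsOver A (j ℕ.+ L))) (letters A)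
        ≈⟨ ∑-cong (letters A) (λ a → ∑-if-∧ (a ==ℤ + suc m) prefixed (g ∘ (a ∷_)) (wordsOver A (j ℕ.+ L))) ⟩
      ∑ (λ a → if a ==ℤ + suc m then ∑ (λ ws → if prefixed ws then g (a ∷ ws) else 0#) (wordsOver A (j ℕ.+ L)) else 0#) (letters A)
        ≈⟨ ∑-select-letter (λ a → ∑ (λ ws → if prefixed ws then g (a ∷ ws) else 0#) (wordsOver A (j ℕ.+ L))) m A m<A ⟩
      ∑ (λ ws → if prefixed ws then g (+ suc m ∷ ws) else 0#) (wordsOver A (j ℕ.+ L))
        ≈⟨ ∑-prefixed A (suc m) j L (g ∘ (+ suc m ∷_)) (≡.subst (_≤ A) (ℕₚ.+-suc m j) m+1+j≤A) ⟩
      ∑ (g ∘ (ascending m (suc j) ++_)) (wordsOver A L) ∎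
    where
      open import Relation.Binary.Reasoning.Setoid setoid
      prefixed : List ℤ → Bool
      prefixed ws = take j ws ==L ascending (suc m) j
      m<A : m < A
      m<A = ℕₚ.<-≤-trans (ℕₚ.m<m+n m (s≤s z≤n)) m+1+j≤A

  ∑-prefixed-short : ∀ (A m j n : ℕ) (g : List ℤ → Carrier) → n < j →
    ∑ (λ ws → if take j ws ==L ascending m j then g ws else 0#) (wordsOver A n) ≈ 0#
  ∑-prefixed-short A m (suc j) zero g _ = +-identityʳ _
  ∑-prefixed-short A m (suc j) (suc n) g (s≤s n<j) =
    trans (∑-wordsOver-suc A n _) (∑-zero (letters A) (λ a →
      trans (∑-if-∧ (a ==ℤ + suc m) (λ ws → take j ws ==L ascending (suc m) j) (g ∘ (a ∷_)) (wordsOver A n))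
            (if-≈0# (a ==ℤ + suc m) (∑-prefixed-short A (suc m) j n (g ∘ (a ∷_)) n<j))))

module _ {c ℓ : Level} (R : CommutativeSemiring c ℓ) (q : CommutativeSemiring.Carrier R) where
  open CommutativeSemiring R
  open Sums R
  open import Relation.Binary.Reasoning.Setoid setoid
  open import Algebra.Solver.Ring.NaturalCoefficients.Default R

  [_]q : ℕ → Carrier
  [ m ]q = qint R q m

  letterPairWeight : ℕ → Carrier
  letterPairWeight i = pow R q (2 ℕ.* suc i) + pow R q (2 ℕ.* suc i ∸ 1)

  letterPairWeight-suc : ∀ i → letterPairWeight (suc i) ≈ (q * q) * letterPairWeight i
  letterPairWeight-suc i = begin
      pow R q (2 ℕ.* suc (suc i)) + pow R q (2 ℕ.* suc (suc i) ∸ 1)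
        ≡⟨ ≡.cong₂ _+_ (≡.cong (pow R q) (ℕₚ.*-suc 2 (suc i))) (≡.cong (λ e → pow R q (e ∸ 1)) (ℕₚ.*-suc 2 (suc i))) ⟩
      q * (q * pow R q (2 ℕ.* suc i)) + q * (q * pow R q (2 ℕ.* suc i ∸ 1))
        ≈⟨ solve 3 (λ q a b → q :* (q :* a) :+ q :* (q :* b) := (q :* q) :* (a :+ b))
                 refl q (pow R q (2 ℕ.* suc i)) (pow R q (2 ℕ.* suc i ∸ 1)) ⟩
      (q * q) * letterPairWeight i ∎

  [2m+1]q≈1+∑< : ∀ m → 1# + ∑< letterPairWeight m ≈ [ 2 ℕ.* m ℕ.+ 1 ]q
  [2m+1]q≈1+∑< zero = +-cong refl (sym (zeroʳ q))
  [2m+1]q≈1+∑< (suc m) = begin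
      1# + (letterPairWeight 0 + ∑< (letterPairWeight ∘ suc) m)
        ≈⟨ +-cong refl (+-cong refl (trans (∑<-cong m (λ i _ → letterPairWeight-suc i)) (∑<-*ˡ letterPairWeight (q * q) m))) ⟩
      1# + (letterPairWeight 0 + (q * q) * ∑< letterPairWeight m)
        ≈⟨ solve 2 (λ q s → con 1 :+ ((q :* (q :* con 1) :+ q :* con 1) :+ (q :* q) :* s)
                          := con 1 :+ q :* (con 1 :+ q :* (con 1 :+ s))) refl q (∑< letterPairWeight m) ⟩
      1# + q * (1# + q * (1# + ∑< letterPairWeight m))
        ≈⟨ +-cong refl (*-cong refl (+-cong refl (*-cong refl ([2m+1]q≈1+∑< m)))) ⟩
      [ suc (suc (2 ℕ.* m ℕ.+ 1)) ]q
        ≡⟨ ≡.cong (λ e → [ e ℕ.+ 1 ]q) (≡.sym (ℕₚ.*-suc 2 m)) ⟩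
      [ 2 ℕ.* suc m ℕ.+ 1 ]q ∎

  admissible : ℕ → ℤ → Bool
  admissible m a = (∣ a ∣ ≤ᵇ m) ∨ (a ==ℤ + suc m)

  ∑-next-letter : ∀ (X : ℕ → Carrier) m A → m < A →
    ∑ (λ a → if admissible m a then wtLetter R q m a * X (m ⊔ ∣ a ∣) else 0#) (letters A)
      ≈ [ 2 ℕ.* m ℕ.+ 1 ]q * X m + X (suc m)
  ∑-next-letter X m A m<A = begin
      ∑ next (letters A)                              ≈⟨ ∑-letters next A ⟩
      next (+ 0) + ∑< pair A                          ≈⟨ +-cong (trans (*-identityˡ _) (reflexive (≡.cong X (ℕₚ.⊔-identityʳ m))))
                                                                (∑<-truncate pair m A m<A pair-above) ⟩
      X m + (∑< pair m + pair m)                      ≈⟨ +-cong refl (+-cong (trans (∑<-cong m pair-below) (∑<-*ʳ letterPairWeight (X m) m))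
                                                                             pair-new-max) ⟩
      X m + (∑< letterPairWeight m * X m + X (suc m))  ≈⟨ solve 3 (λ x s y → x :+ (s :* x :+ y) := (con 1 :+ s) :* x :+ y)
                                                                 refl (X m) (∑< letterPairWeight m) (X (suc m)) ⟩
      (1# + ∑< letterPairWeight m) * X m + X (suc m)   ≈⟨ +-cong (*-cong ([2m+1]q≈1+∑< m) refl) refl ⟩
      [ 2 ℕ.* m ℕ.+ 1 ]q * X m + X (suc m)            ∎
    where
      next : ℤ → Carrier
      next a = if admissible m a then wtLetter R q m a * X (m ⊔ ∣ a ∣) else 0#
      pair : ℕ → Carrier
      pair i = next (+ suc i) + next -[1+ i ]
      pair-below : ∀ i → i < m → pair i ≈ letterPairWeight i * X m
      pair-below i i<m rewrite ≤ᵇ-true i<m | ℕₚ.m≥n⇒m⊔n≡m i<m = sym (distribʳ _ _ _)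
      pair-new-max : pair m ≈ X (suc m)
      pair-new-max rewrite ≤ᵇ-false (ℕₚ.n<1+n m) | ≡ᵇ-refl m | ℕₚ.m≤n⇒m⊔n≡n (ℕₚ.n≤1+n m) =
        trans (+-identityʳ _) (*-identityˡ _)
      pair-above : ∀ i → m < i → pair i ≈ 0#
      pair-above i m<i rewrite ≤ᵇ-false (ℕₚ.<-trans m<i (ℕₚ.n<1+n i)) | ≡ᵇ-false (ℕₚ.>⇒≢ m<i) =
        +-identityˡ _

  rgWeight : ℕ → ℤ → List ℤ → Carrier
  rgWeight m k ws = if rgFrom m ws ∧ (+ (m ⊔ maxAbs ws) ==ℤ k) then wtFrom R q m ws else 0#

  rgWeight-∷ : ∀ m k a ws →
    rgWeight m k (a ∷ ws) ≈ (if admissible m a then wtLetter R q m a * rgWeight (m ⊔ ∣ a ∣) k ws else 0#)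
  rgWeight-∷ m k a ws rewrite ≡.sym (ℕₚ.⊔-assoc m ∣ a ∣ (maxAbs ws)) =
    if-∧-* (admissible m a) (rgFrom (m ⊔ ∣ a ∣) ws) _ _ _
    where
      if-∧-* : ∀ b b′ b″ w x → (if (b ∧ b′) ∧ b″ then w * x else 0#) ≈ (if b then w * (if b′ ∧ b″ then x else 0#) else 0#)
      if-∧-* false b′ b″ w x = refl
      if-∧-* true b′ b″ w x with b′ ∧ b″
      ... | true = refl
      ... | false = sym (zeroʳ w)

  rgWeight-ascending : ∀ m j k vs → rgWeight m k (ascending m j ++ vs) ≈ rgWeight (m ℕ.+ j) k vs
  rgWeight-ascending m zero k vs rewrite ℕₚ.+-identityʳ m = refl
  rgWeight-ascending m (suc j) k vs = begin
      rgWeight m k (+ suc m ∷ ascending (suc m) j ++ vs)  ≈⟨ rgWeight-∷ m k (+ suc m) (ascending (suc m) j ++ vs) ⟩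
      _                                                  ≈⟨ new-max ⟩
      rgWeight (suc m) k (ascending (suc m) j ++ vs)     ≈⟨ rgWeight-ascending (suc m) j k vs ⟩
      rgWeight (suc m ℕ.+ j) k vs                        ≡⟨ ≡.cong (λ e → rgWeight e k vs) (≡.sym (ℕₚ.+-suc m j)) ⟩
      rgWeight (m ℕ.+ suc j) k vs                        ∎
    where
      new-max : (if admissible m (+ suc m) then wtLetter R q m (+ suc m) * rgWeight (m ⊔ suc m) k (ascending (suc m) j ++ vs) else 0#)
                ≈ rgWeight (suc m) k (ascending (suc m) j ++ vs)
      new-max rewrite ≤ᵇ-false (ℕₚ.n<1+n m) | ≡ᵇ-refl m | ℕₚ.m≤n⇒m⊔n≡n (ℕₚ.n≤1+n m) = *-identityˡ _

  rgSum : ℕ → ℕ → ℕ → ℤ → Carrier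
  rgSum A m L k = ∑ (rgWeight m k) (wordsOver A L)

  rgSum-suc : ∀ A m L k → m < A → rgSum A m (suc L) k ≈ [ 2 ℕ.* m ℕ.+ 1 ]q * rgSum A m L k + rgSum A (suc m) L k
  rgSum-suc A m L k m<A = begin
      rgSum A m (suc L) k
        ≈⟨ ∑-wordsOver-suc A L (rgWeight m k) ⟩
      ∑ (λ a → ∑ (rgWeight m k ∘ (a ∷_)) (wordsOver A L)) (letters A)
        ≈⟨ ∑-cong (letters A) first-letter ⟩
      ∑ (λ a → if admissible m a then wtLetter R q m a * rgSum A (m ⊔ ∣ a ∣) L k else 0#) (letters A)
        ≈⟨ ∑-next-letter (λ m′ → rgSum A m′ L k) m A m<A ⟩
      [ 2 ℕ.* m ℕ.+ 1 ]q * rgSum A m L k + rgSum A (suc m) L k ∎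
    where
      first-letter : ∀ a → ∑ (rgWeight m k ∘ (a ∷_)) (wordsOver A L)
                           ≈ (if admissible m a then wtLetter R q m a * rgSum A (m ⊔ ∣ a ∣) L k else 0#)
      first-letter a = trans (∑-cong (wordsOver A L) (rgWeight-∷ m k a))
                             (∑-if-*ˡ (admissible m a) (wtLetter R q m a) _ (wordsOver A L))

  -- rgSum with the alphabet forgotten: by rgSum≈rgTail its size is irrelevant once large enough.
  rgTail : ℕ → ℕ → ℤ → Carrier
  rgTail m zero k = if + m ==ℤ k then 1# else 0#
  rgTail m (suc L) k = [ 2 ℕ.* m ℕ.+ 1 ]q * rgTail m L k + rgTail (suc m) L k

  rgSum≈rgTail : ∀ A m L k → m ℕ.+ L ≤ A → rgSum A m L k ≈ rgTail m L k
  rgSum≈rgTail A m zero k _ rewrite ℕₚ.⊔-identityʳ m = +-identityʳ _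
  rgSum≈rgTail A m (suc L) k m+1+L≤A = begin
      rgSum A m (suc L) k                                       ≈⟨ rgSum-suc A m L k m<A ⟩
      [ 2 ℕ.* m ℕ.+ 1 ]q * rgSum A m L k + rgSum A (suc m) L k  ≈⟨ +-cong (*-cong refl (rgSum≈rgTail A m L k m+L≤A))
                                                                          (rgSum≈rgTail A (suc m) L k 1+m+L≤A) ⟩
      rgTail m (suc L) k                                        ∎
    where
      1+m+L≤A : suc m ℕ.+ L ≤ A
      1+m+L≤A = ≡.subst (_≤ A) (ℕₚ.+-suc m L) m+1+L≤A
      m+L≤A : m ℕ.+ L ≤ A
      m+L≤A = ℕₚ.<⇒≤ 1+m+L≤A
      m<A : m < A
      m<A = ℕₚ.<-≤-trans (ℕₚ.m<m+n m (s≤s z≤n)) m+1+L≤A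

  rgTail-recurrence : ∀ m L k → rgTail m (suc L) k ≈ rgTail m L (k -ℤ 1ℤ) + [ 2 ℕ.* ∣ k ∣ ℕ.+ 1 ]q * rgTail m L k
  rgTail-recurrence m zero k rewrite ==ℤ-pred m k with + m ==ℤ k in m≟k
  ... | true rewrite +==ℤ⇒≡ m k m≟k = +-comm _ _
  ... | false = trans (+-cong (zeroʳ _) refl) (trans (+-comm _ _) (+-cong refl (sym (zeroʳ _))))
  rgTail-recurrence m (suc L) k = begin
      a * rgTail m (suc L) k + rgTail (suc m) (suc L) k
        ≈⟨ +-cong (*-cong refl (rgTail-recurrence m L k)) (rgTail-recurrence (suc m) L k) ⟩
      a * (rgTail m L k′ + b * rgTail m L k) + (rgTail (suc m) L k′ + b * rgTail (suc m) L k)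
        ≈⟨ solve 6 (λ a b x y z w → a :* (x :+ b :* y) :+ (z :+ b :* w) := (a :* x :+ z) :+ b :* (a :* y :+ w))
                 refl a b (rgTail m L k′) (rgTail m L k) (rgTail (suc m) L k′) (rgTail (suc m) L k) ⟩
      rgTail m (suc L) k′ + b * rgTail m (suc L) k ∎
    where
      a = [ 2 ℕ.* m ℕ.+ 1 ]q
      b = [ 2 ℕ.* ∣ k ∣ ℕ.+ 1 ]q
      k′ = k -ℤ 1ℤ

  rgTail-below : ∀ m L k → k <ℤ + m → rgTail m L k ≈ 0#
  rgTail-below m zero k k<m with + m ==ℤ k in m≟k
  ... | true = ⊥-elim (ℤₚ.<-irrefl (+==ℤ⇒≡ m k m≟k) k<m)
  ... | false = refl
  rgTail-below m (suc L) k k<m =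
    trans (+-cong (*-cong refl (rgTail-below m L k k<m))
                  (rgTail-below (suc m) L k (ℤₚ.<-trans k<m (+<+ (ℕₚ.n<1+n m)))))
          (trans (+-identityʳ _) (zeroʳ _))

  rgTail-above : ∀ m L k → + (m ℕ.+ L) <ℤ k → rgTail m L k ≈ 0#
  rgTail-above m zero k m+0<k with + m ==ℤ k in m≟k
  ... | true = ⊥-elim (ℤₚ.<-irrefl (≡.trans (≡.cong +_ (ℕₚ.+-identityʳ m)) (≡.sym (+==ℤ⇒≡ m k m≟k))) m+0<k)
  ... | false = refl
  rgTail-above m (suc L) k m+1+L<k =
    trans (+-cong (*-cong refl (rgTail-above m L k (ℤₚ.<-trans (+<+ (ℕₚ.+-monoʳ-< m (ℕₚ.n<1+n L))) m+1+L<k)))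
                  (rgTail-above (suc m) L k (≡.subst (λ e → + e <ℤ k) (ℕₚ.+-suc m L) m+1+L<k)))
          (trans (+-identityʳ _) (zeroʳ _))

  SB≈∑-prefixed : ∀ n k r →
    SB R q n k r ≈ ∑ (λ ws → if take r ws ==L ascending 0 r then rgWeight 0 k ws else 0#) (wordsOver n n)
  SB≈∑-prefixed n k r = trans (∑-filterᵇ (wt R q) (inR k r) (wordsOver n n)) (∑-cong (wordsOver n n) (λ ws →
      reflexive (≡.trans (if-∧-nest (isRG ws) (+ maxAbs ws ==ℤ k) (hasPrefix r ws) (wt R q ws))
                         (≡.cong (λ p → if take r ws ==L p then rgWeight 0 k ws else 0#) (map-+suc-upTo r)))))
    where
      if-∧-nest : ∀ x y z w → (if x ∧ (y ∧ z) then w else 0#) ≡ (if z then (if x ∧ y then w else 0#) else 0#)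
      if-∧-nest true true z w = ≡.refl
      if-∧-nest true false true w = ≡.refl
      if-∧-nest true false false w = ≡.refl
      if-∧-nest false y true w = ≡.refl
      if-∧-nest false y false w = ≡.refl

  SB≈rgTail : ∀ n k r → r ≤ n → SB R q n k r ≈ rgTail r (n ∸ r) k
  SB≈rgTail n k r r≤n = begin
      SB R q n k r                                            ≈⟨ SB≈∑-prefixed n k r ⟩
      ∑ prefixedWeight (wordsOver n n)                        ≡⟨ ≡.cong (∑ prefixedWeight ∘ wordsOver n) (≡.sym r+[n∸r]≡n) ⟩
      ∑ prefixedWeight (wordsOver n (r ℕ.+ (n ∸ r)))          ≈⟨ ∑-prefixed n 0 r (n ∸ r) (rgWeight 0 k) r≤n ⟩
      ∑ (rgWeight 0 k ∘ (ascending 0 r ++_)) (wordsOver n (n ∸ r))  ≈⟨ ∑-cong (wordsOver n (n ∸ r)) (rgWeight-ascending 0 r k) ⟩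
      rgSum n r (n ∸ r) k                                     ≈⟨ rgSum≈rgTail n r (n ∸ r) k (ℕₚ.≤-reflexive r+[n∸r]≡n) ⟩
      rgTail r (n ∸ r) k                                      ∎
    where
      prefixedWeight : List ℤ → Carrier
      prefixedWeight ws = if take r ws ==L ascending 0 r then rgWeight 0 k ws else 0#
      r+[n∸r]≡n : r ℕ.+ (n ∸ r) ≡ n
      r+[n∸r]≡n = ℕₚ.m+[n∸m]≡n r≤n

  SB-recurrence : ∀ n r k → + r ≤ℤ k → k <ℤ + n →
    SB R q n k r ≈ SB R q (n ∸ 1) (k -ℤ 1ℤ) r + [ 2 ℕ.* ∣ k ∣ ℕ.+ 1 ]q * SB R q (n ∸ 1) k r
  SB-recurrence (suc n) r (+ k) (+≤+ r≤k) (+<+ (s≤s k≤n)) = begin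
      SB R q (suc n) (+ k) r           ≈⟨ SB≈rgTail (suc n) (+ k) r (ℕₚ.m≤n⇒m≤1+n r≤n) ⟩
      rgTail r (suc n ∸ r) (+ k)       ≡⟨ ≡.cong (λ L → rgTail r L (+ k)) (ℕₚ.+-∸-assoc 1 r≤n) ⟩
      rgTail r (suc (n ∸ r)) (+ k)     ≈⟨ rgTail-recurrence r (n ∸ r) (+ k) ⟩
      rgTail r (n ∸ r) (+ k -ℤ 1ℤ) + [ 2 ℕ.* k ℕ.+ 1 ]q * rgTail r (n ∸ r) (+ k)
        ≈⟨ sym (+-cong (SB≈rgTail n _ r r≤n) (*-cong refl (SB≈rgTail n _ r r≤n))) ⟩
      SB R q n (+ k -ℤ 1ℤ) r + [ 2 ℕ.* k ℕ.+ 1 ]q * SB R q n (+ k) r ∎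
    where
      r≤n : r ≤ n
      r≤n = ℕₚ.≤-trans r≤k k≤n

  SB-diagonal : ∀ r → SB R q r (+ r) r ≈ 1#
  SB-diagonal r = begin
      SB R q r (+ r) r          ≈⟨ SB≈rgTail r (+ r) r ℕₚ.≤-refl ⟩
      rgTail r (r ∸ r) (+ r)    ≡⟨ ≡.cong (λ L → rgTail r L (+ r)) (ℕₚ.n∸n≡0 r) ⟩
      rgTail r 0 (+ r)          ≡⟨ ≡.cong (λ b → if b then 1# else 0#) (≡ᵇ-refl r) ⟩
      1#                        ∎

  SB-vanishes : ∀ n r k → (k <ℤ + r) ⊎ (+ n <ℤ k) ⊎ (n < r) → SB R q n k r ≈ 0#
  SB-vanishes n r k out-of-range with r ℕ.≤? n
  ... | no r≰n = trans (SB≈∑-prefixed n k r) (∑-prefixed-short n 0 r n (rgWeight 0 k) (ℕₚ.≰⇒> r≰n))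
  ... | yes r≤n with out-of-range
  ...   | inj₁ k<r = trans (SB≈rgTail n k r r≤n) (rgTail-below r (n ∸ r) k k<r)
  ...   | inj₂ (inj₁ n<k) = trans (SB≈rgTail n k r r≤n)
                              (rgTail-above r (n ∸ r) k (≡.subst (λ e → + e <ℤ k) (≡.sym (ℕₚ.m+[n∸m]≡n r≤n)) n<k))
  ...   | inj₂ (inj₂ n<r) = ⊥-elim (ℕₚ.<⇒≱ n<r r≤n)

proposition3p9 : ∀ {c ℓ} (R : CommutativeSemiring c ℓ) (q : CommutativeSemiring.Carrier R) →
    let open CommutativeSemiring R in
    (∀ (n r : ℕ) (k : ℤ) → + r ≤ℤ k → k <ℤ + n →
      SB R q n k r ≈ (SB R q (n ∸ 1) (k -ℤ 1ℤ) r + (qint R q (2 ℕ.* ∣ k ∣ ℕ.+ 1) * SB R q (n ∸ 1) k r)))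
    × (∀ (r : ℕ) → SB R q r (+ r) r ≈ 1#)
    × (∀ (n r : ℕ) (k : ℤ) → (k <ℤ + r) ⊎ (+ n <ℤ k) ⊎ (n < r) → SB R q n k r ≈ 0#)
proposition3p9 R q = SB-recurrence R q , SB-diagonal R q , SB-vanishes R q
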